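{- Let $(G=(V,E),\mathcal L)$ be a list edge coloring instance, $\beta\ge 2$, and $v\in V$ a vertex such that $|\mathcal L(e)|-\deg(e)\ge\beta$ for every edge $e\in E(v)$. Then for every $F\subseteq E(v)$ and every color $a$, \[\Pr_{G,\mathcal L}[a\in c(F)]\le\frac{|F|}{\beta-1+|F|}\quad\text{and}\quad\frac{\Pr_{G,\mathcal L}[a\in c(F)]}{\Pr_{G,\mathcal L}[a\notin c(E(v))]}\le\frac{|F|}{\beta-1}.\]
   Context: A list edge coloring instance $(G,\mathcal L)$: $G=(V,E)$ finite undirected graph, lists $\mathcal L(e)\subseteq[q]$; $\deg(e)$ is the number of edges other than $e$ sharing an endpoint with $e$; $E(v)$ is the set of edges incident to $v$. A proper edge coloring is $\sigma:E\to[q]$ with $\sigma(e)\in\mathcal L(e)$ and distinct colors on distinct edges sharing an endpoint. $\Pr_{G,\mathcal L}[\cdot]$ is the probability under a uniformly random proper edge coloring $c$, and $a\in c(F)$ means some edge of $F$ receives color $a$.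
   Formalization: The parameter β ranges over the rationals. -}

module Defs where

open import Data.Nat using (ℕ; zero; suc)
open import Data.Fin using (Fin; _≟_)
open import Data.Fin.Properties using (all?; any?)
open import Data.Fin.Subset using (Subset; _∈_; _∉_; ∣_∣)
open import Data.Fin.Subset.Properties using (_∈?_)
open import Data.Product using (_×_; _,_; ∃; proj₁; proj₂)
open import Data.Sum using (_⊎_)
open import Data.List using (List; []; _∷_; map; concatMap; filter; length; allFin)
open import Data.Vec.Functional as VF using ()
open import Relation.Nullary using (¬_; Dec)
open import Relation.Nullary.Decidable using (_×-dec_; _⊎-dec_; ¬?)
open import Relation.Unary using (Decidable)
open import Relation.Binary.PropositionalEquality using (_≡_; _≢_)
open import Data.Integer using (+_)
open import Data.Rational using (ℚ; _/_)

record Graph (n m : ℕ) : Set where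
  field
    ends     : Fin m → Fin n × Fin n
    loopless : ∀ e → proj₁ (ends e) ≢ proj₂ (ends e)
    simple   : ∀ e f →
               ((proj₁ (ends e) ≡ proj₁ (ends f) × proj₂ (ends e) ≡ proj₂ (ends f))
                ⊎ (proj₁ (ends e) ≡ proj₂ (ends f) × proj₂ (ends e) ≡ proj₁ (ends f)))
               → e ≡ f

module _ {n m : ℕ} (G : Graph n m) where
  open Graph G

  Incident : Fin m → Fin n → Set
  Incident e v = proj₁ (ends e) ≡ v ⊎ proj₂ (ends e) ≡ v

  incident? : ∀ e v → Dec (Incident e v)
  incident? e v = (proj₁ (ends e) ≟ v) ⊎-dec (proj₂ (ends e) ≟ v)

  Adjacent : Fin m → Fin m → Set
  Adjacent e f = e ≢ f × (Incident f (proj₁ (ends e)) ⊎ Incident f (proj₂ (ends e)))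

  adjacent? : ∀ e f → Dec (Adjacent e f)
  adjacent? e f = ¬? (e ≟ f) ×-dec (incident? f (proj₁ (ends e)) ⊎-dec incident? f (proj₂ (ends e)))

  deg : Fin m → ℕ
  deg e = length (filter (adjacent? e) (allFin m))

  Proper : {q : ℕ} → (Fin m → Subset q) → (Fin m → Fin q) → Set
  Proper L σ = (∀ e → σ e ∈ L e) × (∀ e f → Adjacent e f → σ e ≢ σ f)

  proper? : {q : ℕ} (L : Fin m → Subset q) → Decidable (Proper L)
  proper? L σ = all? (λ e → σ e ∈? L e)
                ×-dec all? (λ e → all? (λ f → adjacent? e f →-dec' ¬? (σ e ≟ σ f)))
    where
    open import Relation.Nullary.Decidable using () renaming (_→-dec_ to _→-dec'_)

allMaps : (m q : ℕ) → List (Fin m → Fin q)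
allMaps zero    q = (λ ()) ∷ []
allMaps (suc m) q = concatMap (λ c → map (λ σ → c VF.∷ σ) (allMaps m q)) (allFin q)

#maps : {m q : ℕ} {P : (Fin m → Fin q) → Set} → Decidable P → ℕ
#maps {m} {q} P? = length (filter P? (allMaps m q))

ColorIn : {m q : ℕ} → Fin q → Subset m → (Fin m → Fin q) → Set
ColorIn a F c = ∃ λ e → e ∈ F × c e ≡ a

colorIn? : {m q : ℕ} (a : Fin q) (F : Subset m) → Decidable (ColorIn a F)
colorIn? a F c = any? (λ e → (e ∈? F) ×-dec (c e ≟ a))

module _ {n m : ℕ} (G : Graph n m) where
  ColorNotAt : {q : ℕ} → Fin q → Fin n → (Fin m → Fin q) → Set
  ColorNotAt a v c = ¬ (∃ λ e → Incident G e v × c e ≡ a)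

  colorNotAt? : {q : ℕ} (a : Fin q) (v : Fin n) → Decidable (ColorNotAt a v)
  colorNotAt? a v c = ¬? (any? (λ e → incident? G e v ×-dec (c e ≟ a)))

-- counts of proper colorings (numerator/denominator of Pr_{G,L})
  #proper : {q : ℕ} → (Fin m → Subset q) → ℕ
  #proper L = #maps (proper? G L)

  #proper∧ : {q : ℕ} (L : Fin m → Subset q) {P : (Fin m → Fin q) → Set}
             → Decidable P → ℕ
  #proper∧ L P? = #maps (λ c → proper? G L c ×-dec P? c)

ℕ→ℚ : ℕ → ℚ
ℕ→ℚ k = + k / 1

{-# OPTIONS --safe #-}

-- Write X_e for the number of proper colorings with c(e) = a and H for the number with a ∉ c(E(v)).
-- Group all maps E → [q] into the lines {c [ e ]≔ x | x < q}. A line contains at most one coloring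
-- counted by X_e, and if it contains one, then recoloring e by any color of L(e) other than a and
-- the colors of its deg(e) neighbours gives a coloring counted by H, because every edge of E(v)
-- other than e is a neighbour of e. Hence (|L(e)| - deg(e) - 1) X_e ≤ H, so (β - 1) X_e ≤ H, and
-- the union bound over e ∈ F gives (β - 1) #[a ∈ c(F)] ≤ |F| H. The first inequality follows since
-- the events a ∈ c(F) and a ∉ c(E(v)) are disjoint, so #[a ∈ c(F)] + H ≤ #proper.

module Submission where

open import Defs

-- A separate module keeps ℕ's arithmetic operators out of scope of lemma3p1, which uses ℚ's.
module Counting where

  open import Data.Nat.Properties as ℕ using ()
  open import Algebra.Properties.CommutativeSemigroup ℕ.+-commutativeSemigroup using (interchange)
  open import Algebra.Properties.Semiring.Sum ℕ.+-*-semiring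
    using (sum-syntax; ∑-distrib-+; *-distribˡ-sum; *-distribʳ-sum; sum-cong-≗)
  open import Data.Bool using (true; false; if_then_else_)
  open import Data.Empty using (⊥; ⊥-elim)
  open import Data.Fin using (Fin; zero; suc; _≟_)
  open import Data.Fin.Properties using (nonZeroIndex)
  open import Data.Fin.Subset using (Subset; _∈_; ∣_∣; inside; outside; Nonempty)
  open import Data.Fin.Subset.Properties using (_∈?_)
  open import Data.List using (List; []; _∷_; map; concatMap; filter; length; tabulate; allFin; _++_)
  open import Data.List.Extrema.Nat using (argmin; argmin-all; f[argmin]≤f[xs])
  open import Data.List.Membership.Propositional using () renaming (_∈_ to _∈ₗ_; _∉_ to _∉ₗ_)
  open import Data.List.Membership.Propositional.Properties
    using (∈-map⁺; ∈-filter⁺; ∈-filter⁻; ∈-allFin)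
  open import Data.List.Properties using (map-++; map-∘; map-cong; length-map; filter-none)
  open import Data.List.Relation.Unary.All as All using ()
  open import Data.List.Relation.Unary.Any using (here; there; any?)
  open import Data.Nat using (ℕ; zero; suc; _+_; _*_; _∸_; _≤_; z≤n; NonZero)
  open import Data.Nat.ListAction using (sum)
  open import Data.Nat.ListAction.Properties using (sum-++)
  open import Data.Product using (_×_; _,_; proj₁; proj₂; ∃-syntax)
  open import Data.Sum using (inj₁; inj₂)
  open import Data.Vec using ([]; _∷_)
  open import Data.Vec.Functional as Vector using (updateAt)
  open import Data.Vec.Functional.Properties using (updateAt-updates; updateAt-minimal)
  open import Function using (_∘_; const)
  open import Relation.Binary.Core using (_Preserves_⟶_)
  open import Relation.Binary.Definitions using (_Respects_)
  open import Relation.Binary.PropositionalEquality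
  open import Relation.Nullary using (Dec; yes; no; does; ¬_)
  open import Relation.Nullary.Decidable using (_×-dec_; ¬?)
  open import Relation.Unary using (Pred; Decidable)

  private variable
    A B P R : Set
    k m n q : ℕ

  -- Defined through does, so that 𝟙 (Dec.map′ f g d) reduces to 𝟙 d; ∑-𝟙-≟ and ∑-𝟙-∈ rely on it.
  𝟙 : Dec P → ℕ
  𝟙 d = if does d then 1 else 0

  𝟙≤1 : (p? : Dec P) → 𝟙 p? ≤ 1
  𝟙≤1 (yes _) = ℕ.≤-refl
  𝟙≤1 (no _)  = z≤n

  𝟙-mono : (P → R) → (p? : Dec P) (r? : Dec R) → 𝟙 p? ≤ 𝟙 r?
  𝟙-mono P→R (yes p) (yes _) = ℕ.≤-refl
  𝟙-mono P→R (yes p) (no ¬r) = ⊥-elim (¬r (P→R p))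
  𝟙-mono P→R (no _)  _       = z≤n

  𝟙-yes : P → (p? : Dec P) → 𝟙 p? ≡ 1
  𝟙-yes p (yes _) = refl
  𝟙-yes p (no ¬p) = ⊥-elim (¬p p)

  𝟙-no : ¬ P → (p? : Dec P) → 𝟙 p? ≡ 0
  𝟙-no ¬p (yes p) = ⊥-elim (¬p p)
  𝟙-no ¬p (no _)  = refl

  𝟙-cong : (P → R) → (R → P) → (p? : Dec P) (r? : Dec R) → 𝟙 p? ≡ 𝟙 r?
  𝟙-cong P→R R→P p? r? = ℕ.≤-antisym (𝟙-mono P→R p? r?) (𝟙-mono R→P r? p?)

  𝟙-preserves-≗ : {P : Pred (A → B) _} → P Respects _≗_ → (P? : Decidable P) →
                  (𝟙 ∘ P?) Preserves _≗_ ⟶ _≡_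
  𝟙-preserves-≗ resp P? c≗c′ = 𝟙-cong (resp c≗c′) (resp (sym ∘ c≗c′)) (P? _) (P? _)

  -- Sums over Fin n

  ∑-mono : {f g : Fin n → ℕ} → (∀ i → f i ≤ g i) → ∑[ i < n ] f i ≤ ∑[ i < n ] g i
  ∑-mono {zero}  f≤g = z≤n
  ∑-mono {suc n} f≤g = ℕ.+-mono-≤ (f≤g zero) (∑-mono (f≤g ∘ suc))

  ∑-const : ∀ n k → ∑[ i < n ] k ≡ n * k
  ∑-const zero    k = refl
  ∑-const (suc n) k = cong (k +_) (∑-const n k)

  term≤∑ : (f : Fin n → ℕ) (i : Fin n) → f i ≤ ∑[ j < n ] f j
  term≤∑ f zero    = ℕ.m≤m+n (f zero) _
  term≤∑ f (suc i) = ℕ.≤-trans (term≤∑ (f ∘ suc) i) (ℕ.m≤n+m _ (f zero))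

  ∑-𝟙-none : {Q : Pred (Fin n) _} (Q? : Decidable Q) → (∀ i → ¬ Q i) → ∑[ i < n ] 𝟙 (Q? i) ≡ 0
  ∑-𝟙-none {n} Q? ¬Q =
    trans (sum-cong-≗ (λ i → 𝟙-no (¬Q i) (Q? i))) (trans (∑-const n 0) (ℕ.*-zeroʳ n))

  ∑-𝟙-≟ : (a : Fin n) → ∑[ x < n ] 𝟙 (x ≟ a) ≡ 1
  ∑-𝟙-≟ {suc n} zero    = cong suc (∑-𝟙-none {n} (λ i → suc i ≟ zero) (λ i ()))
  ∑-𝟙-≟ {suc n} (suc a) = ∑-𝟙-≟ a

  ∑-𝟙-∈ : (p : Subset n) → ∑[ x < n ] 𝟙 (x ∈? p) ≡ ∣ p ∣
  ∑-𝟙-∈ []            = refl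
  ∑-𝟙-∈ (inside  ∷ p) = cong suc (∑-𝟙-∈ p)
  ∑-𝟙-∈ (outside ∷ p) = ∑-𝟙-∈ p

  infix 4 _∉ₗ?_
  _∉ₗ?_ : (y : Fin n) (ds : List (Fin n)) → Dec (y ∉ₗ ds)
  y ∉ₗ? ds = ¬? (any? (y ≟_) ds)

  ∑-𝟙-∉ₗ : {Q : Pred (Fin n) _} (Q? : Decidable Q) (ds : List (Fin n)) →
           ∑[ y < n ] 𝟙 (Q? y) ≤ ∑[ y < n ] 𝟙 (Q? y ×-dec y ∉ₗ? ds) + length ds
  ∑-𝟙-∉ₗ {n} Q? [] =
    ℕ.≤-trans (∑-mono λ y → 𝟙-mono (_, λ ()) (Q? y) (Q? y ×-dec y ∉ₗ? [])) (ℕ.m≤m+n _ 0)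
  ∑-𝟙-∉ₗ {n} {Q} Q? (d ∷ ds) = begin
    ∑[ y < n ] 𝟙 (Q? y)                   ≤⟨ ∑-𝟙-∉ₗ Q? ds ⟩
    avoiding ds + length ds               ≤⟨ ℕ.+-monoˡ-≤ (length ds) avoiding-d∷ds ⟩
    avoiding (d ∷ ds) + 1 + length ds     ≡⟨ ℕ.+-assoc (avoiding (d ∷ ds)) 1 (length ds) ⟩
    avoiding (d ∷ ds) + length (d ∷ ds)   ∎
    where
    open ℕ.≤-Reasoning
    avoiding : List (Fin n) → ℕ
    avoiding ds = ∑[ y < n ] 𝟙 (Q? y ×-dec y ∉ₗ? ds)
    avoiding-d : ∀ y (y≟d : Dec (y ≡ d)) →
                 𝟙 (Q? y ×-dec y ∉ₗ? ds) ≤ 𝟙 (Q? y ×-dec y ∉ₗ? d ∷ ds) + 𝟙 y≟d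
    avoiding-d y (yes _)  = ℕ.≤-trans (𝟙≤1 (Q? y ×-dec y ∉ₗ? ds)) (ℕ.m≤n+m 1 _)
    avoiding-d y (no y≢d) =
      ℕ.≤-trans (𝟙-mono extend (Q? y ×-dec y ∉ₗ? ds) (Q? y ×-dec y ∉ₗ? d ∷ ds)) (ℕ.m≤m+n _ 0)
      where
      extend : Q y × y ∉ₗ ds → Q y × y ∉ₗ d ∷ ds
      extend (q , y∉ds) = q , λ { (here y≡d) → y≢d y≡d ; (there y∈ds) → y∉ds y∈ds }
    avoiding-d∷ds : avoiding ds ≤ avoiding (d ∷ ds) + 1
    avoiding-d∷ds = begin
      avoiding ds                                            ≤⟨ ∑-mono (λ y → avoiding-d y (y ≟ d)) ⟩
      ∑[ y < n ] (𝟙 (Q? y ×-dec y ∉ₗ? d ∷ ds) + 𝟙 (y ≟ d))   ≡⟨ ∑-distrib-+ {n} _ _ ⟩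
      avoiding (d ∷ ds) + ∑[ y < n ] 𝟙 (y ≟ d)               ≡⟨ cong (avoiding (d ∷ ds) +_) (∑-𝟙-≟ d) ⟩
      avoiding (d ∷ ds) + 1                                  ∎

  ∑-𝟙-∈-weighted : (F : Subset n) (x : Fin n → ℕ) {t h : ℕ} → (∀ e → e ∈ F → t * x e ≤ h) →
                   t * ∑[ e < n ] (𝟙 (e ∈? F) * x e) ≤ ∣ F ∣ * h
  ∑-𝟙-∈-weighted {n} F x {t} {h} bound = begin
    t * ∑[ e < n ] (𝟙 (e ∈? F) * x e)     ≡⟨ *-distribˡ-sum t (λ e → 𝟙 (e ∈? F) * x e) ⟩
    ∑[ e < n ] (t * (𝟙 (e ∈? F) * x e))   ≤⟨ ∑-mono (λ e → pointwise e (e ∈? F)) ⟩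
    ∑[ e < n ] (𝟙 (e ∈? F) * h)           ≡⟨ *-distribʳ-sum h (λ e → 𝟙 (e ∈? F)) ⟨
    (∑[ e < n ] 𝟙 (e ∈? F)) * h           ≡⟨ cong (_* h) (∑-𝟙-∈ F) ⟩
    ∣ F ∣ * h                             ∎
    where
    open ℕ.≤-Reasoning
    pointwise : ∀ e (e∈?F : Dec (e ∈ F)) → t * (𝟙 e∈?F * x e) ≤ 𝟙 e∈?F * h
    pointwise e (yes e∈F) =
      subst₂ _≤_ (cong (t *_) (sym (ℕ.*-identityˡ (x e)))) (sym (ℕ.*-identityˡ h)) (bound e e∈F)
    pointwise e (no _)    = ℕ.≤-reflexive (ℕ.*-zeroʳ t)

  minimiser : (K : Fin m → ℕ) {F : Subset m} → Nonempty F →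
              ∃[ e ] e ∈ F × (∀ f → f ∈ F → K e ≤ K f)
  minimiser {m} K {F} (e₀ , e₀∈F) =
    argmin K e₀ members ,
    argmin-all K {xs = members} {P = _∈ F} e₀∈F
      (All.tabulate (proj₂ ∘ ∈-filter⁻ (_∈? F) {xs = allFin m})) ,
    λ f f∈F → All.lookup (f[argmin]≤f[xs] e₀ members) (∈-filter⁺ (_∈? F) (∈-allFin f) f∈F)
    where
    members = filter (_∈? F) (allFin m)

  -- Sums over lists

  sum-map-mono : {f g : A → ℕ} → (∀ x → f x ≤ g x) → (xs : List A) → sum (map f xs) ≤ sum (map g xs)
  sum-map-mono f≤g []       = z≤n
  sum-map-mono f≤g (x ∷ xs) = ℕ.+-mono-≤ (f≤g x) (sum-map-mono f≤g xs)

  sum-map-+ : (f g : A → ℕ) (xs : List A) →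
              sum (map (λ x → f x + g x) xs) ≡ sum (map f xs) + sum (map g xs)
  sum-map-+ f g []       = refl
  sum-map-+ f g (x ∷ xs) = trans (cong (f x + g x +_) (sum-map-+ f g xs))
                                 (interchange (f x) (g x) (sum (map f xs)) (sum (map g xs)))

  *-distribˡ-sum-map : ∀ k (f : A → ℕ) (xs : List A) →
                       k * sum (map f xs) ≡ sum (map (λ x → k * f x) xs)
  *-distribˡ-sum-map k f []       = ℕ.*-zeroʳ k
  *-distribˡ-sum-map k f (x ∷ xs) =
    trans (ℕ.*-distribˡ-+ k (f x) _) (cong (k * f x +_) (*-distribˡ-sum-map k f xs))

  sum-map-∑-comm : (φ : A → Fin n → ℕ) (xs : List A) →
                   sum (map (λ x → ∑[ i < n ] φ x i) xs) ≡ ∑[ i < n ] sum (map (λ x → φ x i) xs)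
  sum-map-∑-comm {n = n} φ []       = sym (trans (∑-const n 0) (ℕ.*-zeroʳ n))
  sum-map-∑-comm {n = n} φ (x ∷ xs) =
    trans (cong (∑[ i < n ] φ x i +_) (sum-map-∑-comm φ xs)) (sym (∑-distrib-+ (φ x) _))

  sum-map-concatMap : (f : B → ℕ) (g : A → List B) (xs : List A) →
                      sum (map f (concatMap g xs)) ≡ sum (map (λ x → sum (map f (g x))) xs)
  sum-map-concatMap f g []       = refl
  sum-map-concatMap f g (x ∷ xs) = begin
    sum (map f (g x ++ concatMap g xs))                ≡⟨ cong sum (map-++ f (g x) _) ⟩
    sum (map f (g x) ++ map f (concatMap g xs))        ≡⟨ sum-++ (map f (g x)) _ ⟩
    sum (map f (g x)) + sum (map f (concatMap g xs))   ≡⟨ cong (_ +_) (sum-map-concatMap f g xs) ⟩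
    sum (map f (g x)) + sum (map (λ x → sum (map f (g x))) xs) ∎
    where open ≡-Reasoning

  sum-map-tabulate : (f : A → ℕ) (g : Fin n → A) → sum (map f (tabulate g)) ≡ ∑[ i < n ] f (g i)
  sum-map-tabulate {n = zero}  f g = refl
  sum-map-tabulate {n = suc n} f g = cong (f (g zero) +_) (sum-map-tabulate f (g ∘ suc))

  length-filter≡sum-𝟙 : {P : Pred A _} (P? : Decidable P) (xs : List A) →
                        length (filter P? xs) ≡ sum (map (𝟙 ∘ P?) xs)
  length-filter≡sum-𝟙 P? []       = refl
  length-filter≡sum-𝟙 P? (x ∷ xs) with does (P? x)
  ... | true  = cong suc (length-filter≡sum-𝟙 P? xs)
  ... | false = length-filter≡sum-𝟙 P? xs

  -- Sums over all maps Fin m → Fin q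

  ∑-maps : ((Fin m → Fin q) → ℕ) → ℕ
  ∑-maps {m} {q} f = sum (map f (allMaps m q))

  ∑-maps-mono : {f g : (Fin m → Fin q) → ℕ} → (∀ c → f c ≤ g c) → ∑-maps f ≤ ∑-maps g
  ∑-maps-mono {m} {q} f≤g = sum-map-mono f≤g (allMaps m q)

  #maps≡∑-maps-𝟙 : {P : Pred (Fin m → Fin q) _} (P? : Decidable P) → #maps P? ≡ ∑-maps (𝟙 ∘ P?)
  #maps≡∑-maps-𝟙 {m} {q} P? = length-filter≡sum-𝟙 P? (allMaps m q)

  ∑-maps-suc : (f : (Fin (suc m) → Fin q) → ℕ) →
               ∑-maps f ≡ ∑[ x < q ] ∑-maps (λ σ → f (x Vector.∷ σ))
  ∑-maps-suc {m} {q} f = begin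
    sum (map f (concatMap (λ x → map (x Vector.∷_) (allMaps m q)) (allFin q)))
      ≡⟨ sum-map-concatMap f _ (allFin q) ⟩
    sum (map (λ x → sum (map f (map (x Vector.∷_) (allMaps m q)))) (allFin q))
      ≡⟨ sum-map-tabulate (λ x → sum (map f (map (x Vector.∷_) (allMaps m q)))) (λ x → x) ⟩
    ∑[ x < q ] sum (map f (map (x Vector.∷_) (allMaps m q)))
      ≡⟨ sum-cong-≗ {q} (λ x → cong sum (sym (map-∘ (allMaps m q)))) ⟩
    ∑[ x < q ] ∑-maps (λ σ → f (x Vector.∷ σ)) ∎
    where open ≡-Reasoning

  _[_]≔_ : (Fin m → A) → Fin m → A → (Fin m → A)
  c [ e ]≔ x = updateAt c e (const x)

  []≔-updates : (c : Fin m → A) (e : Fin m) {x : A} → (c [ e ]≔ x) e ≡ x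
  []≔-updates c e = updateAt-updates e c

  []≔-agree : (c : Fin m → A) {e f : Fin m} {x y : A} → f ≢ e → (c [ e ]≔ x) f ≡ (c [ e ]≔ y) f
  []≔-agree c {e} {f} f≢e = trans (updateAt-minimal f e c f≢e) (sym (updateAt-minimal f e c f≢e))

  ∑-maps-resample : (e : Fin m) (f : (Fin m → Fin q) → ℕ) → f Preserves _≗_ ⟶ _≡_ →
                    ∑-maps (λ c → ∑[ x < q ] f (c [ e ]≔ x)) ≡ q * ∑-maps f
  ∑-maps-resample {suc m} {q} zero f f-ext = begin
    ∑-maps (λ c → ∑[ x < q ] f (c [ zero ]≔ x))
      ≡⟨ ∑-maps-suc (λ c → ∑[ x < q ] f (c [ zero ]≔ x)) ⟩
    ∑[ y < q ] ∑-maps (λ σ → ∑[ x < q ] f ((y Vector.∷ σ) [ zero ]≔ x))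
      ≡⟨ sum-cong-≗ {q} (λ y → cong sum (map-cong (λ σ → sum-cong-≗ {q} (λ x →
           f-ext λ { zero → refl ; (suc i) → refl })) (allMaps m q))) ⟩
    ∑[ y < q ] ∑-maps (λ σ → ∑[ x < q ] f (x Vector.∷ σ))
      ≡⟨ ∑-const q _ ⟩
    q * ∑-maps (λ σ → ∑[ x < q ] f (x Vector.∷ σ))
      ≡⟨ cong (q *_) (sum-map-∑-comm (λ σ x → f (x Vector.∷ σ)) (allMaps m q)) ⟩
    q * ∑[ x < q ] ∑-maps (λ σ → f (x Vector.∷ σ))
      ≡⟨ cong (q *_) (∑-maps-suc f) ⟨
    q * ∑-maps f ∎
    where open ≡-Reasoning
  ∑-maps-resample {suc m} {q} (suc e) f f-ext = begin
    ∑-maps (λ c → ∑[ x < q ] f (c [ suc e ]≔ x))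
      ≡⟨ ∑-maps-suc (λ c → ∑[ x < q ] f (c [ suc e ]≔ x)) ⟩
    ∑[ y < q ] ∑-maps (λ σ → ∑[ x < q ] f ((y Vector.∷ σ) [ suc e ]≔ x))
      ≡⟨ sum-cong-≗ {q} (λ y → cong sum (map-cong (λ σ → sum-cong-≗ {q} (λ x →
           f-ext λ { zero → refl ; (suc i) → refl })) (allMaps m q))) ⟩
    ∑[ y < q ] ∑-maps (λ σ → ∑[ x < q ] f (y Vector.∷ (σ [ e ]≔ x)))
      ≡⟨ sum-cong-≗ {q} (λ y → ∑-maps-resample e (λ σ → f (y Vector.∷ σ))
           (λ σ≗σ′ → f-ext λ { zero → refl ; (suc i) → σ≗σ′ i })) ⟩
    ∑[ y < q ] (q * ∑-maps (λ σ → f (y Vector.∷ σ)))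
      ≡⟨ *-distribˡ-sum q (λ y → ∑-maps (λ σ → f (y Vector.∷ σ))) ⟨
    q * ∑[ y < q ] ∑-maps (λ σ → f (y Vector.∷ σ))
      ≡⟨ cong (q *_) (∑-maps-suc f) ⟨
    q * ∑-maps f ∎
    where open ≡-Reasoning

  -- Double counting over the lines {c [ e ]≔ x | x < q}: by ∑-maps-resample, summing over the
  -- line through every map counts each map q times.
  ∑-maps-line-bound : .{{_ : NonZero q}} (e : Fin m) {f g : (Fin m → Fin q) → ℕ} →
                      f Preserves _≗_ ⟶ _≡_ → g Preserves _≗_ ⟶ _≡_ →
                      (∀ c → k * ∑[ x < q ] f (c [ e ]≔ x) ≤ ∑[ x < q ] g (c [ e ]≔ x)) →
                      k * ∑-maps f ≤ ∑-maps g
  ∑-maps-line-bound {q} {m} {k} e {f} {g} f-ext g-ext on-lines = ℕ.*-cancelˡ-≤ q (begin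
    q * (k * ∑-maps f)                              ≡⟨ ℕ.*-assoc q k _ ⟨
    q * k * ∑-maps f                                ≡⟨ cong (_* ∑-maps f) (ℕ.*-comm q k) ⟩
    k * q * ∑-maps f                                ≡⟨ ℕ.*-assoc k q _ ⟩
    k * (q * ∑-maps f)                              ≡⟨ cong (k *_) (∑-maps-resample e f f-ext) ⟨
    k * ∑-maps (λ c → ∑[ x < q ] f (c [ e ]≔ x))   ≡⟨ *-distribˡ-sum-map k _ (allMaps m q) ⟩
    ∑-maps (λ c → k * ∑[ x < q ] f (c [ e ]≔ x))   ≤⟨ ∑-maps-mono on-lines ⟩
    ∑-maps (λ c → ∑[ x < q ] g (c [ e ]≔ x))       ≡⟨ ∑-maps-resample e g g-ext ⟩
    q * ∑-maps g                                    ∎)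
    where open ℕ.≤-Reasoning

  #maps-disjoint : {S P R : Pred (Fin m → Fin q) _} (S? : Decidable S) (P? : Decidable P)
                   (R? : Decidable R) → (∀ {c} → P c → R c → ⊥) →
                   #maps (λ c → S? c ×-dec P? c) + #maps (λ c → S? c ×-dec R? c) ≤ #maps S?
  #maps-disjoint {m} {q} {S} {P} {R} S? P? R? P∩R=∅ = begin
    #maps S∧P? + #maps S∧R?                        ≡⟨ cong₂ _+_ (#maps≡∑-maps-𝟙 S∧P?) (#maps≡∑-maps-𝟙 S∧R?) ⟩
    ∑-maps (𝟙 ∘ S∧P?) + ∑-maps (𝟙 ∘ S∧R?)          ≡⟨ sum-map-+ (𝟙 ∘ S∧P?) (𝟙 ∘ S∧R?) (allMaps m q) ⟨
    ∑-maps (λ c → 𝟙 (S∧P? c) + 𝟙 (S∧R? c))         ≤⟨ ∑-maps-mono (λ c → pointwise (S∧P? c) (S∧R? c) (S? c)) ⟩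
    ∑-maps (𝟙 ∘ S?)                                ≡⟨ #maps≡∑-maps-𝟙 S? ⟨
    #maps S?                                       ∎
    where
    open ℕ.≤-Reasoning
    S∧P? = λ c → S? c ×-dec P? c
    S∧R? = λ c → S? c ×-dec R? c
    pointwise : ∀ {c} (sp? : Dec (S c × P c)) (sr? : Dec (S c × R c)) (s? : Dec (S c)) →
                𝟙 sp? + 𝟙 sr? ≤ 𝟙 s?
    pointwise (yes (_ , p)) (yes (_ , r)) s? = ⊥-elim (P∩R=∅ p r)
    pointwise (yes (s , _)) (no _)        s? = ℕ.≤-reflexive (sym (𝟙-yes s s?))
    pointwise (no _)        (yes (s , _)) s? = ℕ.≤-reflexive (sym (𝟙-yes s s?))
    pointwise (no _)        (no _)        s? = z≤n

  #maps-colorIn-∅ : {S : Pred (Fin m → Fin q) _} (S? : Decidable S) (a : Fin q) {F : Subset m} →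
                    ¬ Nonempty F → #maps (λ c → S? c ×-dec colorIn? a F c) ≡ 0
  #maps-colorIn-∅ {m} {q} S? a F≡∅ = cong length (filter-none (λ c → S? c ×-dec colorIn? a _ c)
    (All.universal (λ c (_ , e , e∈F , _) → F≡∅ (e , e∈F)) (allMaps m q)))

  #maps-colorIn≤ : {S : Pred (Fin m → Fin q) _} (S? : Decidable S) (a : Fin q) (F : Subset m) →
                   #maps (λ c → S? c ×-dec colorIn? a F c)
                     ≤ ∑[ e < m ] (𝟙 (e ∈? F) * #maps (λ c → S? c ×-dec c e ≟ a))
  #maps-colorIn≤ {m} {q} {S} S? a F = begin
    #maps (λ c → S? c ×-dec colorIn? a F c)
      ≡⟨ #maps≡∑-maps-𝟙 (λ c → S? c ×-dec colorIn? a F c) ⟩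
    ∑-maps (λ c → 𝟙 (S? c ×-dec colorIn? a F c))
      ≤⟨ ∑-maps-mono (λ c → pointwise c (S? c ×-dec colorIn? a F c)) ⟩
    ∑-maps (λ c → ∑[ e < m ] (𝟙 (e ∈? F) * 𝟙 (at e c)))
      ≡⟨ sum-map-∑-comm (λ c e → 𝟙 (e ∈? F) * 𝟙 (at e c)) (allMaps m q) ⟩
    ∑[ e < m ] ∑-maps (λ c → 𝟙 (e ∈? F) * 𝟙 (at e c))
      ≡⟨ sum-cong-≗ {m} (λ e → *-distribˡ-sum-map (𝟙 (e ∈? F)) (𝟙 ∘ at e) (allMaps m q)) ⟨
    ∑[ e < m ] (𝟙 (e ∈? F) * ∑-maps (𝟙 ∘ at e))
      ≡⟨ sum-cong-≗ {m} (λ e → cong (𝟙 (e ∈? F) *_) (#maps≡∑-maps-𝟙 (at e))) ⟨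
    ∑[ e < m ] (𝟙 (e ∈? F) * #maps (at e)) ∎
    where
    open ℕ.≤-Reasoning
    at : ∀ e c → Dec (S c × c e ≡ a)
    at e c = S? c ×-dec c e ≟ a
    pointwise : ∀ c (d : Dec (S c × ColorIn a F c)) → 𝟙 d ≤ ∑[ e < m ] (𝟙 (e ∈? F) * 𝟙 (at e c))
    pointwise c (yes (s , e , e∈F , ce≡a)) = ℕ.≤-trans
      (ℕ.≤-reflexive (sym (cong₂ _*_ (𝟙-yes e∈F (e ∈? F)) (𝟙-yes (s , ce≡a) (at e c)))))
      (term≤∑ (λ e → 𝟙 (e ∈? F) * 𝟙 (at e c)) e)
    pointwise c (no _) = z≤n

  -- Recoloring one edge

  module _ {n m : ℕ} (G : Graph n m) where

    Adjacent-sym : ∀ {e f} → Adjacent G e f → Adjacent G f e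
    Adjacent-sym (e≢f , inj₁ (inj₁ f₁≡e₁)) = e≢f ∘ sym , inj₁ (inj₁ (sym f₁≡e₁))
    Adjacent-sym (e≢f , inj₁ (inj₂ f₂≡e₁)) = e≢f ∘ sym , inj₂ (inj₁ (sym f₂≡e₁))
    Adjacent-sym (e≢f , inj₂ (inj₁ f₁≡e₂)) = e≢f ∘ sym , inj₁ (inj₂ (sym f₁≡e₂))
    Adjacent-sym (e≢f , inj₂ (inj₂ f₂≡e₂)) = e≢f ∘ sym , inj₂ (inj₂ (sym f₂≡e₂))

    incident⇒adjacent : ∀ {e f v} → e ≢ f → Incident G e v → Incident G f v → Adjacent G e f
    incident⇒adjacent {f = f} e≢f (inj₁ e₁≡v) f∋v = e≢f , inj₁ (subst (Incident G f) (sym e₁≡v) f∋v)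
    incident⇒adjacent {f = f} e≢f (inj₂ e₂≡v) f∋v = e≢f , inj₂ (subst (Incident G f) (sym e₂≡v) f∋v)

    ColorNotAt-resp-≗ : ∀ {q} {a : Fin q} {v} → ColorNotAt G a v Respects _≗_
    ColorNotAt-resp-≗ c≗c′ a∉c[v] (f , f∋v , c′f≡a) = a∉c[v] (f , f∋v , trans (c≗c′ f) c′f≡a)

    module _ {q : ℕ} (L : Fin m → Subset q) where

      Proper-resp-≗ : Proper G L Respects _≗_
      Proper-resp-≗ c≗c′ (inL , distinct) =
        (λ e → subst (_∈ L e) (c≗c′ e) (inL e)) ,
        (λ e f adj c′e≡c′f → distinct e f adj (trans (c≗c′ e) (trans c′e≡c′f (sym (c≗c′ f)))))

      recolor-proper : ∀ {c : Fin m → Fin q} {e x y} → Proper G L (c [ e ]≔ x) → y ∈ L e →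
                       (∀ f → Adjacent G e f → y ≢ c f) → Proper G L (c [ e ]≔ y)
      recolor-proper {c} {e} {x} {y} (inL , distinct) y∈Le y-fresh = inL′ , distinct′
        where
        fresh : ∀ {f} → Adjacent G e f → (c [ e ]≔ y) e ≢ (c [ e ]≔ y) f
        fresh {f} adj eq = y-fresh f adj
          (trans (sym ([]≔-updates c e)) (trans eq (updateAt-minimal f e c (proj₁ adj ∘ sym))))
        inL′ : ∀ f → (c [ e ]≔ y) f ∈ L f
        inL′ f with f ≟ e
        ... | yes refl = subst (_∈ L e) (sym ([]≔-updates c e)) y∈Le
        ... | no f≢e   = subst (_∈ L f) ([]≔-agree c f≢e) (inL f)
        distinct′ : ∀ f₁ f₂ → Adjacent G f₁ f₂ → (c [ e ]≔ y) f₁ ≢ (c [ e ]≔ y) f₂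
        distinct′ f₁ f₂ adj with f₁ ≟ e | f₂ ≟ e
        ... | yes refl | yes refl = ⊥-elim (proj₁ adj refl)
        ... | yes refl | no _     = fresh adj
        ... | no _     | yes refl = fresh (Adjacent-sym adj) ∘ sym
        ... | no f₁≢e  | no f₂≢e  = λ eq → distinct f₁ f₂ adj
          (trans ([]≔-agree c f₁≢e) (trans eq ([]≔-agree c f₂≢e)))

      recolor-avoids : ∀ {c : Fin m → Fin q} {e v a y} → Incident G e v → Proper G L (c [ e ]≔ a) →
                       y ≢ a → ColorNotAt G a v (c [ e ]≔ y)
      recolor-avoids {c} {e} e∋v (_ , distinct) y≢a (f , f∋v , c′f≡a) with f ≟ e
      ... | yes refl = y≢a (trans (sym ([]≔-updates c e)) c′f≡a)
      ... | no f≢e   = distinct e f (incident⇒adjacent (f≢e ∘ sym) e∋v f∋v)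
                         (trans ([]≔-updates c e) (sym (trans ([]≔-agree c f≢e) c′f≡a)))

  module _ {n m q : ℕ} (G : Graph n m) (L : Fin m → Subset q) (v : Fin n) (a : Fin q) where

    -- Lower bound for the number of colors of L(e) other than a and the colors of e's neighbours.
    spare : Fin m → ℕ
    spare e = ∣ L e ∣ ∸ deg G e ∸ 1

    spare≤#recolorings : ∀ {c : Fin m → Fin q} {e} → Incident G e v → Proper G L (c [ e ]≔ a) →
                         spare e ≤ ∑[ y < q ] 𝟙 (proper? G L (c [ e ]≔ y) ×-dec colorNotAt? G a v (c [ e ]≔ y))
    spare≤#recolorings {c} {e} e∋v proper-a = ℕ.≤-trans spare≤allowed (∑-mono allowed⇒good)
      where
      neighbours : List (Fin m)
      neighbours = filter (adjacent? G e) (allFin m)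
      forbidden : List (Fin q)
      forbidden = a ∷ map c neighbours
      allowed = ∑[ y < q ] 𝟙 (y ∈? L e ×-dec y ∉ₗ? forbidden)
      counted : ∣ L e ∣ ≤ allowed + suc (deg G e)
      counted = subst₂ (λ l d → l ≤ allowed + suc d) (∑-𝟙-∈ (L e)) (length-map c neighbours)
                       (∑-𝟙-∉ₗ (_∈? L e) forbidden)
      spare≤allowed : spare e ≤ allowed
      spare≤allowed = ℕ.m≤n+o⇒m∸n≤o (∣ L e ∣ ∸ deg G e) 1 (ℕ.m≤n+o⇒m∸n≤o ∣ L e ∣ (deg G e)
        (subst (∣ L e ∣ ≤_) (trans (ℕ.+-comm allowed _) (sym (ℕ.+-suc (deg G e) allowed))) counted))
      allowed⇒good : ∀ y → 𝟙 (y ∈? L e ×-dec y ∉ₗ? forbidden)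
                          ≤ 𝟙 (proper? G L (c [ e ]≔ y) ×-dec colorNotAt? G a v (c [ e ]≔ y))
      allowed⇒good y = 𝟙-mono (λ (y∈Le , y∉forbidden) →
          recolor-proper G L proper-a y∈Le (λ f adj y≡cf → y∉forbidden (there
            (subst (_∈ₗ _) (sym y≡cf) (∈-map⁺ c (∈-filter⁺ (adjacent? G e) (∈-allFin f) adj))))) ,
          recolor-avoids G L e∋v proper-a (y∉forbidden ∘ here))
        (y ∈? L e ×-dec y ∉ₗ? forbidden) (proper? G L (c [ e ]≔ y) ×-dec colorNotAt? G a v (c [ e ]≔ y))

    spare-line-bound : ∀ {e} → Incident G e v → ∀ c →
                       spare e * ∑[ x < q ] 𝟙 (proper? G L (c [ e ]≔ x) ×-dec (c [ e ]≔ x) e ≟ a)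
                         ≤ ∑[ y < q ] 𝟙 (proper? G L (c [ e ]≔ y) ×-dec colorNotAt? G a v (c [ e ]≔ y))
    spare-line-bound {e} e∋v c with proper? G L (c [ e ]≔ a)
    ... | yes proper-a = begin
      spare e * ∑[ x < q ] 𝟙 (colored-a x)   ≤⟨ ℕ.*-monoʳ-≤ (spare e) at-most-one ⟩
      spare e * 1                             ≡⟨ ℕ.*-identityʳ (spare e) ⟩
      spare e                                 ≤⟨ spare≤#recolorings e∋v proper-a ⟩
      ∑[ y < q ] 𝟙 (proper? G L (c [ e ]≔ y) ×-dec colorNotAt? G a v (c [ e ]≔ y)) ∎
      where
      open ℕ.≤-Reasoning
      colored-a = λ x → proper? G L (c [ e ]≔ x) ×-dec (c [ e ]≔ x) e ≟ a
      at-most-one : ∑[ x < q ] 𝟙 (colored-a x) ≤ 1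
      at-most-one = ℕ.≤-trans
        (∑-mono λ x → 𝟙-mono (λ (_ , c′e≡a) → trans (sym ([]≔-updates c e)) c′e≡a) (colored-a x) (x ≟ a))
        (ℕ.≤-reflexive (∑-𝟙-≟ a))
    ... | no ¬proper-a = ℕ.≤-trans (ℕ.≤-reflexive (trans (cong (spare e *_) none) (ℕ.*-zeroʳ (spare e)))) z≤n
      where
      none : ∑[ x < q ] 𝟙 (proper? G L (c [ e ]≔ x) ×-dec (c [ e ]≔ x) e ≟ a) ≡ 0
      none = ∑-𝟙-none (λ x → proper? G L (c [ e ]≔ x) ×-dec (c [ e ]≔ x) e ≟ a) λ x (proper-x , c′e≡a) →
        ¬proper-a (subst (λ y → Proper G L (c [ e ]≔ y)) (trans (sym ([]≔-updates c e)) c′e≡a) proper-x)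

    spare*#coloredAt≤#colorNotAt : ∀ {e} → Incident G e v →
                                   spare e * #proper∧ G L (λ c → c e ≟ a) ≤ #proper∧ G L (colorNotAt? G a v)
    spare*#coloredAt≤#colorNotAt {e} e∋v =
      subst₂ (λ X H → spare e * X ≤ H)
        (sym (#maps≡∑-maps-𝟙 (λ c → proper? G L c ×-dec c e ≟ a)))
        (sym (#maps≡∑-maps-𝟙 (λ c → proper? G L c ×-dec colorNotAt? G a v c)))
        (∑-maps-line-bound {k = spare e} {{nonZeroIndex a}} e
          (𝟙-preserves-≗ (λ c≗c′ (p , ce≡a) → Proper-resp-≗ G L c≗c′ p , trans (sym (c≗c′ e)) ce≡a)
                         (λ c → proper? G L c ×-dec c e ≟ a))
          (𝟙-preserves-≗ (λ c≗c′ (p , a∉c[v]) → Proper-resp-≗ G L c≗c′ p , ColorNotAt-resp-≗ G c≗c′ a∉c[v])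
                         (λ c → proper? G L c ×-dec colorNotAt? G a v c))
          (spare-line-bound e∋v))

    t*#colorIn≤∣F∣*#colorNotAt : (F : Subset m) → (∀ e → e ∈ F → Incident G e v) →
                                 ∀ {t} → (∀ e → e ∈ F → t ≤ spare e) →
                                 t * #proper∧ G L (colorIn? a F) ≤ ∣ F ∣ * #proper∧ G L (colorNotAt? G a v)
    t*#colorIn≤∣F∣*#colorNotAt F F⊆E[v] {t} t≤spare = ℕ.≤-trans
      (ℕ.*-monoʳ-≤ t (#maps-colorIn≤ (proper? G L) a F))
      (∑-𝟙-∈-weighted F (λ e → #proper∧ G L (λ c → c e ≟ a)) {t} λ e e∈F →
        ℕ.≤-trans (ℕ.*-monoˡ-≤ _ (t≤spare e e∈F)) (spare*#coloredAt≤#colorNotAt (F⊆E[v] e e∈F)))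

    #colorIn+#colorNotAt≤#proper : (F : Subset m) → (∀ e → e ∈ F → Incident G e v) →
                                   #proper∧ G L (colorIn? a F) + #proper∧ G L (colorNotAt? G a v) ≤ #proper G L
    #colorIn+#colorNotAt≤#proper F F⊆E[v] =
      #maps-disjoint (proper? G L) (colorIn? a F) (colorNotAt? G a v)
        λ (e , e∈F , ce≡a) a∉c[v] → a∉c[v] (e , F⊆E[v] e e∈F , ce≡a)

open Counting
  using (spare; minimiser; #maps-colorIn-∅; t*#colorIn≤∣F∣*#colorNotAt; #colorIn+#colorNotAt≤#proper)

-- Passing to ℚ

open import Data.Fin using (Fin)
open import Data.Fin.Subset using (Subset; _∈_; ∣_∣; Nonempty)
open import Data.Fin.Subset.Properties using (nonempty?)
open import Data.Integer as ℤ using (+_)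
import Data.Integer.Properties as ℤ
open import Data.Nat as ℕ using (ℕ; z≤n)
import Data.Nat.Coprimality as Coprime
import Data.Nat.Properties as ℕ
open import Data.Product using (_×_; _,_)
open import Data.Rational using (ℚ; mkℚ; _/_; _≤_; _+_; _-_; _*_; 1ℚ; NonNegative; *≤*)
import Data.Rational.Properties as ℚ
open import Algebra.Properties.AbelianGroup ℚ.+-0-abelianGroup using (xyx⁻¹≈y)
open import Relation.Binary.PropositionalEquality
open import Relation.Nullary using (Dec; yes; no)

-- ℕ→ℚ k = + k / 1 is stuck on a gcd computation; on mkℚ (+ k) 0 _ the operations of ℚ compute.
ℕ→ℚ≡mkℚ : ∀ k → ℕ→ℚ k ≡ mkℚ (+ k) 0 (Coprime.sym (Coprime.1-coprimeTo k))
ℕ→ℚ≡mkℚ k = ℚ.normalize-coprime (Coprime.sym (Coprime.1-coprimeTo k))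

ℕ→ℚ-homo-+ : ∀ m n → ℕ→ℚ (m ℕ.+ n) ≡ ℕ→ℚ m + ℕ→ℚ n
ℕ→ℚ-homo-+ m n rewrite ℕ→ℚ≡mkℚ m | ℕ→ℚ≡mkℚ n =
  cong (_/ 1) (sym (cong₂ ℤ._+_ (ℤ.*-identityʳ (+ m)) (ℤ.*-identityʳ (+ n))))

ℕ→ℚ-homo-* : ∀ m n → ℕ→ℚ (m ℕ.* n) ≡ ℕ→ℚ m * ℕ→ℚ n
ℕ→ℚ-homo-* m n rewrite ℕ→ℚ≡mkℚ m | ℕ→ℚ≡mkℚ n = cong (_/ 1) (ℤ.pos-* m n)

ℕ→ℚ-mono-≤ : ∀ {m n} → m ℕ.≤ n → ℕ→ℚ m ≤ ℕ→ℚ n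
ℕ→ℚ-mono-≤ {m} {n} m≤n rewrite ℕ→ℚ≡mkℚ m | ℕ→ℚ≡mkℚ n =
  *≤* (subst₂ ℤ._≤_ (sym (ℤ.*-identityʳ (+ m))) (sym (ℤ.*-identityʳ (+ n))) (ℤ.+≤+ m≤n))

ℕ→ℚ-nonNeg : ∀ k → NonNegative (ℕ→ℚ k)
ℕ→ℚ-nonNeg k = ℚ.normalize-nonNeg k 1

ℕ→ℚ-∸ : ∀ m n → ℕ→ℚ m - ℕ→ℚ n ≤ ℕ→ℚ (m ℕ.∸ n)
ℕ→ℚ-∸ m n = begin
  ℕ→ℚ m - ℕ→ℚ n                        ≤⟨ ℚ.+-monoˡ-≤ _ (ℕ→ℚ-mono-≤ (ℕ.m≤n+m∸n m n)) ⟩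
  ℕ→ℚ (n ℕ.+ (m ℕ.∸ n)) - ℕ→ℚ n        ≡⟨ cong (_- ℕ→ℚ n) (ℕ→ℚ-homo-+ n (m ℕ.∸ n)) ⟩
  ℕ→ℚ n + ℕ→ℚ (m ℕ.∸ n) - ℕ→ℚ n        ≡⟨ xyx⁻¹≈y (ℕ→ℚ n) (ℕ→ℚ (m ℕ.∸ n)) ⟩
  ℕ→ℚ (m ℕ.∸ n)                         ∎
  where open ℚ.≤-Reasoning

β-1≤spare : ∀ {β} l d → β ≤ ℕ→ℚ l - ℕ→ℚ d → β - 1ℚ ≤ ℕ→ℚ (l ℕ.∸ d ℕ.∸ 1)
β-1≤spare {β} l d β≤l-d = begin
  β - 1ℚ                    ≤⟨ ℚ.+-monoˡ-≤ _ β≤l-d ⟩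
  ℕ→ℚ l - ℕ→ℚ d - 1ℚ        ≤⟨ ℚ.+-monoˡ-≤ _ (ℕ→ℚ-∸ l d) ⟩
  ℕ→ℚ (l ℕ.∸ d) - 1ℚ        ≤⟨ ℕ→ℚ-∸ (l ℕ.∸ d) 1 ⟩
  ℕ→ℚ (l ℕ.∸ d ℕ.∸ 1)       ∎
  where open ℚ.≤-Reasoning

-- The naturals below are explicit arguments, since Agda cannot infer k from ℕ→ℚ k.
scaled-bound : ∀ β t x f h → β - 1ℚ ≤ ℕ→ℚ t → t ℕ.* x ℕ.≤ f ℕ.* h →
               ℕ→ℚ x * (β - 1ℚ) ≤ ℕ→ℚ f * ℕ→ℚ h
scaled-bound β t x f h β-1≤t tx≤fh = begin
  ℕ→ℚ x * (β - 1ℚ)     ≤⟨ ℚ.*-monoˡ-≤-nonNeg (ℕ→ℚ x) {{ℕ→ℚ-nonNeg x}} β-1≤t ⟩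
  ℕ→ℚ x * ℕ→ℚ t        ≡⟨ ℚ.*-comm (ℕ→ℚ x) (ℕ→ℚ t) ⟩
  ℕ→ℚ t * ℕ→ℚ x        ≡⟨ ℕ→ℚ-homo-* t x ⟨
  ℕ→ℚ (t ℕ.* x)        ≤⟨ ℕ→ℚ-mono-≤ tx≤fh ⟩
  ℕ→ℚ (f ℕ.* h)        ≡⟨ ℕ→ℚ-homo-* f h ⟩
  ℕ→ℚ f * ℕ→ℚ h        ∎
  where open ℚ.≤-Reasoning

null-bound : ∀ β x f h → x ≡ 0 → ℕ→ℚ x * β ≤ ℕ→ℚ f * ℕ→ℚ h
null-bound β .0 f h refl = begin
  ℕ→ℚ 0 * β         ≡⟨ ℚ.*-zeroˡ β ⟩
  ℕ→ℚ 0             ≤⟨ ℕ→ℚ-mono-≤ {n = f ℕ.* h} z≤n ⟩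
  ℕ→ℚ (f ℕ.* h)     ≡⟨ ℕ→ℚ-homo-* f h ⟩
  ℕ→ℚ f * ℕ→ℚ h     ∎
  where open ℚ.≤-Reasoning

total-bound : ∀ β x h N f → x ℕ.+ h ℕ.≤ N → ℕ→ℚ x * (β - 1ℚ) ≤ ℕ→ℚ f * ℕ→ℚ h →
              ℕ→ℚ x * (β - 1ℚ + ℕ→ℚ f) ≤ ℕ→ℚ f * ℕ→ℚ N
total-bound β x h N f x+h≤N x[β-1]≤fh = begin
  ℕ→ℚ x * (β - 1ℚ + ℕ→ℚ f)              ≡⟨ ℚ.*-distribˡ-+ (ℕ→ℚ x) (β - 1ℚ) (ℕ→ℚ f) ⟩
  ℕ→ℚ x * (β - 1ℚ) + ℕ→ℚ x * ℕ→ℚ f      ≤⟨ ℚ.+-monoˡ-≤ _ x[β-1]≤fh ⟩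
  ℕ→ℚ f * ℕ→ℚ h + ℕ→ℚ x * ℕ→ℚ f         ≡⟨ cong (λ y → ℕ→ℚ f * ℕ→ℚ h + y) (ℚ.*-comm (ℕ→ℚ x) (ℕ→ℚ f)) ⟩
  ℕ→ℚ f * ℕ→ℚ h + ℕ→ℚ f * ℕ→ℚ x         ≡⟨ ℚ.*-distribˡ-+ (ℕ→ℚ f) (ℕ→ℚ h) (ℕ→ℚ x) ⟨
  ℕ→ℚ f * (ℕ→ℚ h + ℕ→ℚ x)               ≡⟨ cong (ℕ→ℚ f *_) (ℕ→ℚ-homo-+ h x) ⟨
  ℕ→ℚ f * ℕ→ℚ (h ℕ.+ x)
    ≤⟨ ℚ.*-monoˡ-≤-nonNeg (ℕ→ℚ f) {{ℕ→ℚ-nonNeg f}} (ℕ→ℚ-mono-≤ h+x≤N) ⟩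
  ℕ→ℚ f * ℕ→ℚ N                         ∎
  where
  open ℚ.≤-Reasoning
  h+x≤N = subst (ℕ._≤ N) (ℕ.+-comm x h) x+h≤N

lemma3p1 : {n m q : ℕ} (G : Graph n m) (L : Fin m → Subset q) (β : ℚ) (v : Fin n)
    → ℕ→ℚ 2 ≤ β
    → (∀ e → Incident G e v → β ≤ ℕ→ℚ ∣ L e ∣ - ℕ→ℚ (deg G e))
    → (F : Subset m) → (∀ e → e ∈ F → Incident G e v) → (a : Fin q)
    → (ℕ→ℚ (#proper∧ G L (colorIn? a F)) * (β - 1ℚ + ℕ→ℚ ∣ F ∣)
         ≤ ℕ→ℚ ∣ F ∣ * ℕ→ℚ (#proper G L))
      × (ℕ→ℚ (#proper∧ G L (colorIn? a F)) * (β - 1ℚ)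
         ≤ ℕ→ℚ ∣ F ∣ * ℕ→ℚ (#proper∧ G L (colorNotAt? G a v)))
lemma3p1 G L β v _ β≤slack F F⊆E[v] a =
  total-bound β X H (#proper G L) ∣ F ∣ (#colorIn+#colorNotAt≤#proper G L v a F F⊆E[v]) X-bound ,
  X-bound
  where
  X = #proper∧ G L (colorIn? a F)
  H = #proper∧ G L (colorNotAt? G a v)
  -- Case split by a helper: a with-abstraction on nonempty? F makes Agda exhaust its memory.
  by-cases : Dec (Nonempty F) → ℕ→ℚ X * (β - 1ℚ) ≤ ℕ→ℚ ∣ F ∣ * ℕ→ℚ H
  by-cases (yes F≢∅) =
    let e , e∈F , e-minimal = minimiser (spare G L v a) F≢∅
    in  scaled-bound β (spare G L v a e) X ∣ F ∣ H
          (β-1≤spare ∣ L e ∣ (deg G e) (β≤slack e (F⊆E[v] e e∈F)))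
          (t*#colorIn≤∣F∣*#colorNotAt G L v a F F⊆E[v] e-minimal)
  by-cases (no F≡∅) = null-bound (β - 1ℚ) X ∣ F ∣ H (#maps-colorIn-∅ (proper? G L) a F≡∅)
  X-bound : ℕ→ℚ X * (β - 1ℚ) ≤ ℕ→ℚ ∣ F ∣ * ℕ→ℚ H
  X-bound = by-cases (nonempty? F)
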